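{- In any strong AMD code over a group $\mathcal{G}$ of order $n$, for a source $s$ one has $\hat\epsilon_s=\frac{a-a_s}{n-1}$ if and only if $\epsilon_{\Delta,s}=\frac{a-a_s}{n-1}$ for every $\Delta\in\mathcal{G}\setminus\{0\}$.
   Context: Let $\mathcal{G}$ be a finite additive abelian group of order $n\ge2$ and $\mathcal{S}$ a set of $m$ sources. An AMD code consists of pairwise disjoint nonempty subsets $A(s)\subseteq\mathcal{G}$ ($s\in\mathcal{S}$) and a (possibly randomized) public encoding function $E$ mapping $s$ to some $g\in A(s)$ with probability $\Pr[E(s)=g]$. Write $a_s=|A(s)|$, $a=\sum_s a_s$. Strong security game for a source $s$: the source $s$ is given to the adversary, who then chooses $\Delta\in\mathcal{G}\setminus\{0\}$ by a (possibly randomized) strategy depending on $s$; then $g=E(s)$ is computed; the adversary wins iff $g+\Delta\in A(s')$ for some $s'\ne s$. $\hat\epsilon_s$ is the maximum winning probability over all strategies for source $s$, and $\epsilon_{\Delta,s}$ is the winning probability for source $s$ of the strategy that always chooses $\Delta$.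
   Formalization: The encoding probabilities $\Pr[E(s)=g]$ and the probabilities with which the adversary's randomized strategies choose each Δ are rational. -}

module Defs where

open import Data.Bool using (Bool; true; false; _∧_; _∨_; not)
open import Data.Nat using (ℕ; zero; suc; _+_; _∸_)
open import Data.Fin using (Fin; _≟_)
import Data.Fin as F
open import Data.Fin.Subset using (Subset; _∈_; _∉_; ∣_∣; Nonempty)
open import Data.Vec using (lookup)
open import Data.Integer using (+_)
open import Data.Rational using (ℚ; 0ℚ; 1ℚ; _≤_; _/_) renaming (_+_ to _+ℚ_; _*_ to _*ℚ_)
open import Data.Product using (Σ; _×_; _,_)
open import Relation.Binary.PropositionalEquality using (_≡_; _≢_)
open import Relation.Nullary.Decidable using (⌊_⌋)
open import Algebra.Structures using (IsAbelianGroup)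

∑ℚ : {k : ℕ} → (Fin k → ℚ) → ℚ
∑ℚ {zero}  f = 0ℚ
∑ℚ {suc k} f = f F.zero +ℚ ∑ℚ (λ i → f (F.suc i))

∑ℕ : {k : ℕ} → (Fin k → ℕ) → ℕ
∑ℕ {zero}  f = 0
∑ℕ {suc k} f = f F.zero + ∑ℕ (λ i → f (F.suc i))

anyᶠ : {k : ℕ} → (Fin k → Bool) → Bool
anyᶠ {zero}  f = false
anyᶠ {suc k} f = f F.zero ∨ anyᶠ (λ i → f (F.suc i))

𝟙 : Bool → ℚ
𝟙 true  = 1ℚ
𝟙 false = 0ℚ

-- A finite additive abelian group of order n, with carrier Fin n
-- (every finite abelian group of order n is isomorphic to one of this form).
record FinAbGroup (n : ℕ) : Set where
  field
    _⊕_ : Fin n → Fin n → Fin n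
    𝟘   : Fin n
    ⊖_  : Fin n → Fin n
    isAbelianGroup : IsAbelianGroup _≡_ _⊕_ 𝟘 ⊖_

-- An AMD code over a group G (carrier Fin n) with m sources (Fin m).
-- A s : the subset A(s) of G;  P s g : Pr[E(s) = g].
record AMDCode {n : ℕ} (G : FinAbGroup n) (m : ℕ) : Set where
  field
    A         : Fin m → Subset n
    nonempty  : ∀ s → Nonempty (A s)
    disjoint  : ∀ s s' → s ≢ s' → ∀ g → g ∈ A s → g ∉ A s'
    P         : Fin m → Fin n → ℚ
    P-nonneg  : ∀ s g → 0ℚ ≤ P s g
    P-sum     : ∀ s → ∑ℚ (P s) ≡ 1ℚ
    P-support : ∀ s g → P s g ≢ 0ℚ → g ∈ A s

module _ {n m : ℕ} {G : FinAbGroup n} (C : AMDCode G m) where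
  open FinAbGroup G
  open AMDCode C

  aₛ : Fin m → ℕ
  aₛ s = ∣ A s ∣

  a : ℕ
  a = ∑ℕ aₛ

  inOther : Fin m → Fin n → Bool
  inOther s h = anyᶠ (λ s' → not ⌊ s' ≟ s ⌋ ∧ lookup (A s') h)

  -- ε_{Δ,s}: winning probability of the strategy always choosing Δ
  ε : Fin n → Fin m → ℚ
  ε Δ s = ∑ℚ (λ g → P s g *ℚ 𝟙 (inOther s (g ⊕ Δ)))

  record Strategy : Set where
    field
      σ        : Fin n → ℚ
      σ-nonneg : ∀ Δ → 0ℚ ≤ σ Δ
      σ-zero   : σ 𝟘 ≡ 0ℚ
      σ-sum    : ∑ℚ σ ≡ 1ℚ

  -- winning probability of a strategy for source s
  -- (Δ is drawn from σ independently of E(s))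
  winProb : Strategy → Fin m → ℚ
  winProb str s = ∑ℚ (λ Δ → Strategy.σ str Δ *ℚ ε Δ s)

  IsEpsHat : Fin m → ℚ → Set
  IsEpsHat s x = Σ Strategy (λ str → winProb str s ≡ x)
               × (∀ str → winProb str s ≤ x)

{-# OPTIONS --safe #-}
-- Translation by Δ permutes G, so summing ε_{Δ,s} over all Δ counts, for each
-- value g of E(s), the elements g + Δ lying in the other sets:
-- Σ_Δ ε_{Δ,s} = a − a_s.  Since E(s) ∈ A(s) and the A(s') are disjoint,
-- ε_{0,s} = 0, so the n − 1 values ε_{Δ,s} with Δ ≠ 0 add up to a − a_s.
-- Each of them is the winning probability of a pure strategy, hence at most
-- ε̂_s; if ε̂_s equals their average they must all be equal to it.  Conversely,
-- if they all equal (a − a_s)/(n − 1) then so does every mixture of them,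
-- i.e. the winning probability of every strategy.
module Submission where

open import Defs
open import Data.Nat using (ℕ; suc; _∸_)
open import Data.Fin using (Fin)
open import Data.Integer using (+_)
open import Data.Rational using (ℚ; _/_)
open import Data.Product using (_×_)
open import Relation.Binary.PropositionalEquality using (_≡_; _≢_)

open import Algebra.Bundles using (Group)
open import Algebra.Core using (Op₁; Op₂)
open import Algebra.Structures using (IsGroup; IsAbelianGroup)
import Algebra.Properties.CommutativeMonoid.Sum as MonoidSum
import Algebra.Properties.Group as GroupProperties
open import Data.Bool using (Bool; true; false; _∧_; not)
open import Data.Bool.Properties using (∧-conicalʳ; ¬-not)
open import Data.Fin using (zero; suc; _≟_; punchIn; punchOut)
open import Data.Fin.Permutation using (Permutation′; permutation)
open import Data.Fin.Properties using (suc-injective; punchInᵢ≢i; punchIn-punchOut)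
open import Data.Fin.Subset using (Subset; _∈_; ∣_∣)
import Data.Integer as ℤ
import Data.Integer.Properties as ℤₚ
open import Data.Integer.Tactic.RingSolver using (solve-∀)
import Data.Nat as ℕ
import Data.Nat.Properties as ℕₚ
open import Data.Product using (_,_)
open import Data.Rational using (0ℚ; 1ℚ; _≤_; *≤*; _+_; _*_; toℚᵘ)
open import Data.Rational.Properties renaming (_≟_ to _≟ℚ_)
open import Data.Rational.Unnormalised using (mkℚᵘ; *≡*) renaming (_≃_ to _≃ᵘ_; _+_ to _+ᵘ_; _*_ to _*ᵘ_)
import Data.Rational.Unnormalised.Properties as ℚᵘ
open import Data.Vec using ([]; _∷_; lookup)
open import Data.Vec.Properties using (lookup⇒[]=)
open import Function using (_∘_)
open import Level using (0ℓ)
open import Relation.Binary.PropositionalEquality using (refl; sym; trans; cong; cong₂; subst; module ≡-Reasoning)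
open import Relation.Nullary using (yes; no; contradiction)
open import Relation.Nullary.Decidable using (⌊_⌋; isYes≗does; dec-true; dec-false)

ι : ℕ → ℚ
ι n = + n / 1

toℚᵘ-ι : ∀ n → toℚᵘ (ι n) ≃ᵘ mkℚᵘ (+ n) 0
toℚᵘ-ι n = toℚᵘ-fromℚᵘ (mkℚᵘ (+ n) 0)

ι-+ : ∀ m n → ι (m ℕ.+ n) ≡ ι m + ι n
ι-+ m n = toℚᵘ-injective (begin
  toℚᵘ (ι (m ℕ.+ n))            ≈⟨ toℚᵘ-ι (m ℕ.+ n) ⟩
  mkℚᵘ (+ (m ℕ.+ n)) 0          ≈⟨ cross-multiplied ⟩
  mkℚᵘ (+ m) 0 +ᵘ mkℚᵘ (+ n) 0  ≈⟨ ℚᵘ.+-cong (toℚᵘ-ι m) (toℚᵘ-ι n) ⟨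
  toℚᵘ (ι m) +ᵘ toℚᵘ (ι n)      ≈⟨ toℚᵘ-homo-+ (ι m) (ι n) ⟨
  toℚᵘ (ι m + ι n)              ∎)
  where
  open ℚᵘ.≃-Reasoning
  ring : ∀ x y → (x ℤ.+ y) ℤ.* + 1 ≡ (x ℤ.* + 1 ℤ.+ y ℤ.* + 1) ℤ.* + 1
  ring = solve-∀
  cross-multiplied : mkℚᵘ (+ (m ℕ.+ n)) 0 ≃ᵘ mkℚᵘ (+ m) 0 +ᵘ mkℚᵘ (+ n) 0
  cross-multiplied = *≡* (trans (cong (ℤ._* + 1) (ℤₚ.pos-+ m n)) (ring (+ m) (+ n)))

ι*-/-cancel : ∀ i d → ι (suc d) * (i / suc d) ≡ i / 1
ι*-/-cancel i d = toℚᵘ-injective (begin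
  toℚᵘ (ι (suc d) * (i / suc d))        ≈⟨ toℚᵘ-homo-* (ι (suc d)) (i / suc d) ⟩
  toℚᵘ (ι (suc d)) *ᵘ toℚᵘ (i / suc d)  ≈⟨ ℚᵘ.*-cong (toℚᵘ-ι (suc d)) (toℚᵘ-fromℚᵘ (mkℚᵘ i d)) ⟩
  mkℚᵘ (+ suc d) 0 *ᵘ mkℚᵘ i d          ≈⟨ cross-multiplied ⟩
  mkℚᵘ i 0                              ≈⟨ toℚᵘ-fromℚᵘ (mkℚᵘ i 0) ⟨
  toℚᵘ (i / 1)                          ∎)
  where
  open ℚᵘ.≃-Reasoning
  ring : ∀ x y → (x ℤ.* y) ℤ.* + 1 ≡ y ℤ.* x
  ring = solve-∀
  -- The denominator of the product computes to 1 + (d + 0), not to 1 + d.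
  cross-multiplied : mkℚᵘ (+ suc d) 0 *ᵘ mkℚᵘ i d ≃ᵘ mkℚᵘ i 0
  cross-multiplied = *≡* (trans (ring (+ suc d) i) (cong (λ e → i ℤ.* + suc e) (sym (ℕₚ.+-identityʳ d))))

ι-∑ℕ : ∀ {k} (f : Fin k → ℕ) → ι (∑ℕ f) ≡ ∑ℚ (ι ∘ f)
ι-∑ℕ {ℕ.zero} f = refl
ι-∑ℕ {suc k}  f = trans (ι-+ (f zero) _) (cong (_+_ (ι (f zero))) (ι-∑ℕ (f ∘ suc)))

module ℕΣ = MonoidSum ℕₚ.+-0-commutativeMonoid
module ℚΣ = MonoidSum +-0-commutativeMonoid

∑ℕ≗sum : ∀ {k} (f : Fin k → ℕ) → ∑ℕ f ≡ ℕΣ.sum f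
∑ℕ≗sum {ℕ.zero} f = refl
∑ℕ≗sum {suc k}  f = cong (f zero ℕ.+_) (∑ℕ≗sum (f ∘ suc))

∑ℚ≗sum : ∀ {k} (f : Fin k → ℚ) → ∑ℚ f ≡ ℚΣ.sum f
∑ℚ≗sum {ℕ.zero} f = refl
∑ℚ≗sum {suc k}  f = cong (_+_ (f zero)) (∑ℚ≗sum (f ∘ suc))

∑ℕ-∸ : ∀ {k} (f : Fin (suc k) → ℕ) j → ∑ℕ f ∸ f j ≡ ∑ℕ (f ∘ punchIn j)
∑ℕ-∸ f j = begin
  ∑ℕ f ∸ f j                             ≡⟨ cong (_∸ f j) (∑ℕ≗sum f) ⟩
  ℕΣ.sum f ∸ f j                         ≡⟨ cong (_∸ f j) (ℕΣ.sum-remove {i = j} f) ⟩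
  f j ℕ.+ ℕΣ.sum (f ∘ punchIn j) ∸ f j   ≡⟨ ℕₚ.m+n∸m≡n (f j) _ ⟩
  ℕΣ.sum (f ∘ punchIn j)                 ≡⟨ ∑ℕ≗sum (f ∘ punchIn j) ⟨
  ∑ℕ (f ∘ punchIn j)                     ∎
  where open ≡-Reasoning

∑ℚ-cong : ∀ {k} {f g : Fin k → ℚ} → (∀ i → f i ≡ g i) → ∑ℚ f ≡ ∑ℚ g
∑ℚ-cong {ℕ.zero} f≗g = refl
∑ℚ-cong {suc k}  f≗g = cong₂ _+_ (f≗g zero) (∑ℚ-cong (f≗g ∘ suc))

∑ℚ-*ˡ : ∀ {k} c (f : Fin k → ℚ) → c * ∑ℚ f ≡ ∑ℚ (λ i → c * f i)
∑ℚ-*ˡ {ℕ.zero} c f = *-zeroʳ c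
∑ℚ-*ˡ {suc k}  c f =
  trans (*-distribˡ-+ c (f zero) _) (cong (_+_ (c * f zero)) (∑ℚ-*ˡ c (f ∘ suc)))

∑ℚ-*ʳ : ∀ {k} c (f : Fin k → ℚ) → ∑ℚ f * c ≡ ∑ℚ (λ i → f i * c)
∑ℚ-*ʳ {ℕ.zero} c f = *-zeroˡ c
∑ℚ-*ʳ {suc k}  c f =
  trans (*-distribʳ-+ c (f zero) _) (cong (_+_ (f zero * c)) (∑ℚ-*ʳ c (f ∘ suc)))

∑ℚ-const : ∀ {k} c → ∑ℚ {k} (λ _ → c) ≡ ι k * c
∑ℚ-const {ℕ.zero} c = sym (*-zeroˡ c)
∑ℚ-const {suc k}  c = begin
  c + ∑ℚ {k} (λ _ → c)    ≡⟨ cong₂ _+_ (sym (*-identityˡ c)) (∑ℚ-const {k} c) ⟩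
  1ℚ * c + ι k * c        ≡⟨ *-distribʳ-+ c 1ℚ (ι k) ⟨
  (1ℚ + ι k) * c          ≡⟨ cong (_* c) (ι-+ 1 k) ⟨
  ι (suc k) * c           ∎
  where open ≡-Reasoning

∑ℚ-0 : ∀ {k} → ∑ℚ {k} (λ _ → 0ℚ) ≡ 0ℚ
∑ℚ-0 {k} = trans (∑ℚ-const {k} 0ℚ) (*-zeroʳ (ι k))

∑ℚ-comm : ∀ {k l} (f : Fin k → Fin l → ℚ) →
          ∑ℚ (λ i → ∑ℚ (f i)) ≡ ∑ℚ (λ j → ∑ℚ (λ i → f i j))
∑ℚ-comm f = begin
  ∑ℚ (λ i → ∑ℚ (f i))                   ≡⟨ ∑ℚ-cong (λ i → ∑ℚ≗sum (f i)) ⟩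
  ∑ℚ (λ i → ℚΣ.sum (f i))               ≡⟨ ∑ℚ≗sum (λ i → ℚΣ.sum (f i)) ⟩
  ℚΣ.sum (λ i → ℚΣ.sum (f i))           ≡⟨ ℚΣ.∑-comm f ⟩
  ℚΣ.sum (λ j → ℚΣ.sum (λ i → f i j))   ≡⟨ ∑ℚ≗sum (λ j → ℚΣ.sum (λ i → f i j)) ⟨
  ∑ℚ (λ j → ℚΣ.sum (λ i → f i j))       ≡⟨ ∑ℚ-cong (λ j → ∑ℚ≗sum (λ i → f i j)) ⟨
  ∑ℚ (λ j → ∑ℚ (λ i → f i j))           ∎
  where open ≡-Reasoning

∑ℚ-remove : ∀ {k} (f : Fin (suc k) → ℚ) i → ∑ℚ f ≡ f i + ∑ℚ (f ∘ punchIn i)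
∑ℚ-remove f i = begin
  ∑ℚ f                           ≡⟨ ∑ℚ≗sum f ⟩
  ℚΣ.sum f                       ≡⟨ ℚΣ.sum-remove {i = i} f ⟩
  f i + ℚΣ.sum (f ∘ punchIn i)   ≡⟨ cong (_+_ (f i)) (∑ℚ≗sum (f ∘ punchIn i)) ⟨
  f i + ∑ℚ (f ∘ punchIn i)       ∎
  where open ≡-Reasoning

groupOn : ∀ {k} {_∙_ : Op₂ (Fin k)} {e : Fin k} {_⁻¹ : Op₁ (Fin k)} →
          IsGroup _≡_ _∙_ e _⁻¹ → Group 0ℓ 0ℓ
groupOn isGroup = record { isGroup = isGroup }

∑ℚ-translate : ∀ {k} {_∙_ : Op₂ (Fin k)} {e : Fin k} {_⁻¹ : Op₁ (Fin k)} →
               IsGroup _≡_ _∙_ e _⁻¹ → ∀ g (f : Fin k → ℚ) → ∑ℚ (λ x → f (g ∙ x)) ≡ ∑ℚ f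
∑ℚ-translate {k} {_∙_} {_} {_⁻¹} isGroup g f =
  trans (∑ℚ≗sum (λ x → f (g ∙ x))) (trans (sym (ℚΣ.sum-permute f translation)) (sym (∑ℚ≗sum f)))
  where
  open GroupProperties (groupOn isGroup)
  translation : Permutation′ k
  translation = permutation (g ∙_) (λ y → (g ⁻¹) ∙ y) (\\-leftDividesˡ g) (\\-leftDividesʳ g)

∑ℚ-mono-≤ : ∀ {k} {f g : Fin k → ℚ} → (∀ i → f i ≤ g i) → ∑ℚ f ≤ ∑ℚ g
∑ℚ-mono-≤ {ℕ.zero} f≤g = ≤-refl
∑ℚ-mono-≤ {suc k}  f≤g = +-mono-≤ (f≤g zero) (∑ℚ-mono-≤ (f≤g ∘ suc))

∑ℚ-≤-≡⇒≡ : ∀ {k} {f g : Fin k → ℚ} → (∀ i → f i ≤ g i) → ∑ℚ f ≡ ∑ℚ g → ∀ i → f i ≡ g i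
∑ℚ-≤-≡⇒≡ {suc k} {f} {g} f≤g ∑f≡∑g i = ≤-antisym (f≤g i) (≮⇒≥ λ fᵢ<gᵢ →
  <-irrefl split-sums (+-mono-<-≤ fᵢ<gᵢ (∑ℚ-mono-≤ (f≤g ∘ punchIn i))))
  where
  split-sums : f i + ∑ℚ (f ∘ punchIn i) ≡ g i + ∑ℚ (g ∘ punchIn i)
  split-sums = trans (sym (∑ℚ-remove f i)) (trans ∑f≡∑g (∑ℚ-remove g i))

⌊≟⌋-refl : ∀ {k} (j : Fin k) → ⌊ j ≟ j ⌋ ≡ true
⌊≟⌋-refl j = trans (isYes≗does (j ≟ j)) (dec-true (j ≟ j) refl)

⌊≟⌋-≢ : ∀ {k} {i j : Fin k} → i ≢ j → ⌊ i ≟ j ⌋ ≡ false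
⌊≟⌋-≢ {i = i} {j} i≢j = trans (isYes≗does (i ≟ j)) (dec-false (i ≟ j) i≢j)

0≤𝟙 : ∀ b → 0ℚ ≤ 𝟙 b
0≤𝟙 true  = *≤* (ℤ.+≤+ ℕ.z≤n)
0≤𝟙 false = ≤-refl

𝟙-∧ : ∀ x y → 𝟙 (x ∧ y) ≡ 𝟙 x * 𝟙 y
𝟙-∧ true  y = sym (*-identityˡ (𝟙 y))
𝟙-∧ false y = sym (*-zeroˡ (𝟙 y))

∑ℚ-dirac : ∀ {k} j (f : Fin k → ℚ) → ∑ℚ (λ i → 𝟙 ⌊ i ≟ j ⌋ * f i) ≡ f j
∑ℚ-dirac {suc k} j f = begin
  ∑ℚ w                                   ≡⟨ ∑ℚ-remove w j ⟩
  w j + ∑ℚ (w ∘ punchIn j)               ≡⟨ cong₂ _+_ diagonal (∑ℚ-cong off-diagonal) ⟩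
  f j + ∑ℚ {k} (λ _ → 0ℚ)                ≡⟨ cong (_+_ (f j)) (∑ℚ-0 {k}) ⟩
  f j + 0ℚ                               ≡⟨ +-identityʳ (f j) ⟩
  f j                                    ∎
  where
  open ≡-Reasoning
  w : Fin (suc k) → ℚ
  w i = 𝟙 ⌊ i ≟ j ⌋ * f i
  diagonal : w j ≡ f j
  diagonal = trans (cong (λ b → 𝟙 b * f j) (⌊≟⌋-refl j)) (*-identityˡ (f j))
  off-diagonal : ∀ i → w (punchIn j i) ≡ 0ℚ
  off-diagonal i = trans (cong (λ b → 𝟙 b * f (punchIn j i)) (⌊≟⌋-≢ (punchInᵢ≢i j i)))
                         (*-zeroˡ (f (punchIn j i)))

ι-∑ℕ-∸ : ∀ {k} (f : Fin k → ℕ) j → ι (∑ℕ f ∸ f j) ≡ ∑ℚ (λ i → 𝟙 (not ⌊ i ≟ j ⌋) * ι (f i))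
ι-∑ℕ-∸ {suc k} f j = begin
  ι (∑ℕ f ∸ f j)               ≡⟨ cong ι (∑ℕ-∸ f j) ⟩
  ι (∑ℕ (f ∘ punchIn j))       ≡⟨ ι-∑ℕ (f ∘ punchIn j) ⟩
  ∑ℚ (ι ∘ f ∘ punchIn j)       ≡⟨ ∑ℚ-cong off-diagonal ⟩
  ∑ℚ (w ∘ punchIn j)           ≡⟨ +-identityˡ (∑ℚ (w ∘ punchIn j)) ⟨
  0ℚ + ∑ℚ (w ∘ punchIn j)      ≡⟨ cong (_+ ∑ℚ (w ∘ punchIn j)) diagonal ⟨
  w j + ∑ℚ (w ∘ punchIn j)     ≡⟨ ∑ℚ-remove w j ⟨
  ∑ℚ w                         ∎
  where
  open ≡-Reasoning
  w : Fin (suc k) → ℚ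
  w i = 𝟙 (not ⌊ i ≟ j ⌋) * ι (f i)
  diagonal : w j ≡ 0ℚ
  diagonal = trans (cong (λ b → 𝟙 (not b) * ι (f j)) (⌊≟⌋-refl j)) (*-zeroˡ (ι (f j)))
  off-diagonal : ∀ i → ι (f (punchIn j i)) ≡ w (punchIn j i)
  off-diagonal i = sym (trans (cong (λ b → 𝟙 (not b) * ι (f (punchIn j i))) (⌊≟⌋-≢ (punchInᵢ≢i j i)))
                              (*-identityˡ _))

ι∣p∣≡∑𝟙 : ∀ {k} (p : Subset k) → ι ∣ p ∣ ≡ ∑ℚ (λ h → 𝟙 (lookup p h))
ι∣p∣≡∑𝟙 []          = refl
ι∣p∣≡∑𝟙 (true ∷ p)  = trans (ι-+ 1 ∣ p ∣) (cong (_+_ 1ℚ) (ι∣p∣≡∑𝟙 p))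
ι∣p∣≡∑𝟙 (false ∷ p) = trans (ι∣p∣≡∑𝟙 p) (sym (+-identityˡ _))

anyᶠ-false : ∀ {k} (b : Fin k → Bool) → (∀ i → b i ≡ false) → anyᶠ b ≡ false
anyᶠ-false {ℕ.zero} b b≡false = refl
anyᶠ-false {suc k}  b b≡false rewrite b≡false zero = anyᶠ-false (b ∘ suc) (b≡false ∘ suc)

𝟙-anyᶠ : ∀ {k} (b : Fin k → Bool) → (∀ i j → b i ≡ true → b j ≡ true → i ≡ j) →
         𝟙 (anyᶠ b) ≡ ∑ℚ (𝟙 ∘ b)
𝟙-anyᶠ {ℕ.zero} b unique = refl
𝟙-anyᶠ {suc k}  b unique with b zero in b₀≡true
... | true  = sym (trans (cong (_+_ 1ℚ) (trans (∑ℚ-cong rest-false) (∑ℚ-0 {k}))) (+-identityʳ 1ℚ))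
  where
  rest-false : ∀ i → 𝟙 (b (suc i)) ≡ 0ℚ
  rest-false i with b (suc i) in bᵢ≡true
  ... | true  = contradiction (unique zero (suc i) b₀≡true bᵢ≡true) λ ()
  ... | false = refl
... | false = trans (𝟙-anyᶠ (b ∘ suc) (λ i j bᵢ bⱼ → suc-injective (unique (suc i) (suc j) bᵢ bⱼ)))
                   (sym (+-identityˡ _))

module _ {n m : ℕ} {G : FinAbGroup n} (C : AMDCode G m) (s : Fin m) where
  open FinAbGroup G
  open AMDCode C
  open IsAbelianGroup isAbelianGroup using (isGroup; identityʳ)

  -- inOther C s h unfolds to anyᶠ (inOtherAt h).
  inOtherAt : Fin n → Fin m → Bool
  inOtherAt h s′ = not ⌊ s′ ≟ s ⌋ ∧ lookup (A s′) h

  inOtherAt-unique : ∀ h i j → inOtherAt h i ≡ true → inOtherAt h j ≡ true → i ≡ j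
  inOtherAt-unique h i j h∈i h∈j with i ≟ j
  ... | yes i≡j = i≡j
  ... | no  i≢j = contradiction (in-set j h∈j) (disjoint i j i≢j h (in-set i h∈i))
    where
    in-set : ∀ s′ → inOtherAt h s′ ≡ true → h ∈ A s′
    in-set s′ h∈s′ = lookup⇒[]= h (A s′) (∧-conicalʳ _ _ h∈s′)

  ∑𝟙inOther≡a∸aₛ : ∑ℚ (λ h → 𝟙 (inOther C s h)) ≡ ι (a C ∸ aₛ C s)
  ∑𝟙inOther≡a∸aₛ = begin
    ∑ℚ (λ h → 𝟙 (inOther C s h))                ≡⟨ ∑ℚ-cong (λ h → 𝟙-anyᶠ (inOtherAt h) (inOtherAt-unique h)) ⟩
    ∑ℚ (λ h → ∑ℚ (λ s′ → 𝟙 (inOtherAt h s′)))   ≡⟨ ∑ℚ-comm (λ h s′ → 𝟙 (inOtherAt h s′)) ⟩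
    ∑ℚ (λ s′ → ∑ℚ (λ h → 𝟙 (inOtherAt h s′)))   ≡⟨ ∑ℚ-cong count ⟩
    ∑ℚ (λ s′ → other s′ * ι (aₛ C s′))          ≡⟨ ι-∑ℕ-∸ (aₛ C) s ⟨
    ι (a C ∸ aₛ C s)                            ∎
    where
    open ≡-Reasoning
    other : Fin m → ℚ
    other s′ = 𝟙 (not ⌊ s′ ≟ s ⌋)
    count : ∀ s′ → ∑ℚ (λ h → 𝟙 (inOtherAt h s′)) ≡ other s′ * ι (aₛ C s′)
    count s′ = begin
      ∑ℚ (λ h → 𝟙 (inOtherAt h s′))           ≡⟨ ∑ℚ-cong (λ h → 𝟙-∧ (not ⌊ s′ ≟ s ⌋) (lookup (A s′) h)) ⟩
      ∑ℚ (λ h → other s′ * 𝟙 (lookup (A s′) h)) ≡⟨ ∑ℚ-*ˡ (other s′) (𝟙 ∘ lookup (A s′)) ⟨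
      other s′ * ∑ℚ (𝟙 ∘ lookup (A s′))        ≡⟨ cong (_*_ (other s′)) (ι∣p∣≡∑𝟙 (A s′)) ⟨
      other s′ * ι (aₛ C s′)                   ∎

  ∑ε≡a∸aₛ : ∑ℚ (λ Δ → ε C Δ s) ≡ ι (a C ∸ aₛ C s)
  ∑ε≡a∸aₛ = begin
    ∑ℚ (λ Δ → ∑ℚ (λ g → P s g * won g Δ))   ≡⟨ ∑ℚ-comm (λ Δ g → P s g * won g Δ) ⟩
    ∑ℚ (λ g → ∑ℚ (λ Δ → P s g * won g Δ))   ≡⟨ ∑ℚ-cong (λ g → ∑ℚ-*ˡ (P s g) (won g)) ⟨
    ∑ℚ (λ g → P s g * ∑ℚ (won g))           ≡⟨ ∑ℚ-cong (λ g → cong (_*_ (P s g)) (won-count g)) ⟩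
    ∑ℚ (λ g → P s g * N)                    ≡⟨ ∑ℚ-*ʳ N (P s) ⟨
    ∑ℚ (P s) * N                            ≡⟨ cong (_* N) (P-sum s) ⟩
    1ℚ * N                                  ≡⟨ *-identityˡ N ⟩
    N                                       ∎
    where
    open ≡-Reasoning
    N : ℚ
    N = ι (a C ∸ aₛ C s)
    won : Fin n → Fin n → ℚ
    won g Δ = 𝟙 (inOther C s (g ⊕ Δ))
    won-count : ∀ g → ∑ℚ (won g) ≡ N
    won-count g = trans (∑ℚ-translate isGroup g (𝟙 ∘ inOther C s)) ∑𝟙inOther≡a∸aₛ

  inOther-false : ∀ g → g ∈ A s → inOther C s g ≡ false
  inOther-false g g∈Aₛ = anyᶠ-false (inOtherAt g) not-at
    where
    not-at : ∀ s′ → inOtherAt g s′ ≡ false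
    not-at s′ with s′ ≟ s
    ... | yes _   = refl
    ... | no s′≢s = ¬-not λ g∈Aₛ′ → disjoint s s′ (s′≢s ∘ sym) g g∈Aₛ (lookup⇒[]= g (A s′) g∈Aₛ′)

  ε-𝟘 : ε C 𝟘 s ≡ 0ℚ
  ε-𝟘 = trans (∑ℚ-cong term-0) (∑ℚ-0 {n})
    where
    term-0 : ∀ g → P s g * 𝟙 (inOther C s (g ⊕ 𝟘)) ≡ 0ℚ
    term-0 g rewrite identityʳ g with P s g ≟ℚ 0ℚ
    ... | yes Pg≡0 = trans (cong (_* 𝟙 (inOther C s g)) Pg≡0) (*-zeroˡ (𝟙 (inOther C s g)))
    ... | no  Pg≢0 = trans (cong (λ b → P s g * 𝟙 b) (inOther-false g (P-support s g Pg≢0))) (*-zeroʳ (P s g))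

  always : ∀ Δ → Δ ≢ 𝟘 → Strategy C
  always Δ Δ≢𝟘 = record
    { σ        = λ Δ′ → 𝟙 ⌊ Δ′ ≟ Δ ⌋
    ; σ-nonneg = λ Δ′ → 0≤𝟙 ⌊ Δ′ ≟ Δ ⌋
    ; σ-zero   = cong 𝟙 (⌊≟⌋-≢ (Δ≢𝟘 ∘ sym))
    ; σ-sum    = trans (∑ℚ-cong (λ Δ′ → sym (*-identityʳ (𝟙 ⌊ Δ′ ≟ Δ ⌋)))) (∑ℚ-dirac Δ (λ _ → 1ℚ))
    }

  winProb-always : ∀ Δ (Δ≢𝟘 : Δ ≢ 𝟘) → winProb C (always Δ Δ≢𝟘) s ≡ ε C Δ s
  winProb-always Δ _ = ∑ℚ-dirac Δ (λ Δ′ → ε C Δ′ s)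

  ε≤ε̂ : ∀ {x} → IsEpsHat C s x → ∀ Δ → Δ ≢ 𝟘 → ε C Δ s ≤ x
  ε≤ε̂ {x} (_ , maximal) Δ Δ≢𝟘 = subst (_≤ x) (winProb-always Δ Δ≢𝟘) (maximal (always Δ Δ≢𝟘))

  winProb-const : ∀ {c} → (∀ Δ → Δ ≢ 𝟘 → ε C Δ s ≡ c) → ∀ str → winProb C str s ≡ c
  winProb-const {c} ε≡c str = begin
    ∑ℚ (λ Δ → σ Δ * ε C Δ s)   ≡⟨ ∑ℚ-cong term ⟩
    ∑ℚ (λ Δ → σ Δ * c)         ≡⟨ ∑ℚ-*ʳ c σ ⟨
    ∑ℚ σ * c                   ≡⟨ cong (_* c) σ-sum ⟩
    1ℚ * c                     ≡⟨ *-identityˡ c ⟩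
    c                          ∎
    where
    open ≡-Reasoning
    open Strategy str
    term : ∀ Δ → σ Δ * ε C Δ s ≡ σ Δ * c
    term Δ with Δ ≟ 𝟘
    ... | yes refl rewrite σ-zero = trans (*-zeroˡ (ε C 𝟘 s)) (sym (*-zeroˡ c))
    ... | no  Δ≢𝟘 = cong (_*_ (σ Δ)) (ε≡c Δ Δ≢𝟘)

  ε̂≡-if-ε-const : ∀ {x c} → IsEpsHat C s x → (∀ Δ → Δ ≢ 𝟘 → ε C Δ s ≡ c) → x ≡ c
  ε̂≡-if-ε-const ((str , attains) , _) ε≡c = trans (sym attains) (winProb-const ε≡c str)

module _ {n m : ℕ} {G : FinAbGroup (suc n)} (C : AMDCode G m) (s : Fin m) where
  open FinAbGroup G

  ∑ε-nonzero≡a∸aₛ : ∑ℚ (λ j → ε C (punchIn 𝟘 j) s) ≡ ι (a C ∸ aₛ C s)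
  ∑ε-nonzero≡a∸aₛ = begin
    rest                  ≡⟨ +-identityˡ rest ⟨
    0ℚ + rest             ≡⟨ cong (_+ rest) (ε-𝟘 C s) ⟨
    ε C 𝟘 s + rest        ≡⟨ ∑ℚ-remove (λ Δ → ε C Δ s) 𝟘 ⟨
    ∑ℚ (λ Δ → ε C Δ s)    ≡⟨ ∑ε≡a∸aₛ C s ⟩
    ι (a C ∸ aₛ C s)      ∎
    where
    open ≡-Reasoning
    rest : ℚ
    rest = ∑ℚ (λ j → ε C (punchIn 𝟘 j) s)

  ε≡ε̂-if-ε̂-average : ∀ {x} → IsEpsHat C s x → ι n * x ≡ ι (a C ∸ aₛ C s) →
                      ∀ Δ → Δ ≢ 𝟘 → ε C Δ s ≡ x
  ε≡ε̂-if-ε̂-average {x} x-is-ε̂ average Δ Δ≢𝟘 = begin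
    ε C Δ s                          ≡⟨ cong (λ Δ′ → ε C Δ′ s) (punchIn-punchOut 𝟘≢Δ) ⟨
    ε C (punchIn 𝟘 (punchOut 𝟘≢Δ)) s  ≡⟨ ∑ℚ-≤-≡⇒≡ below-ε̂ sums-agree (punchOut 𝟘≢Δ) ⟩
    x                                ∎
    where
    open ≡-Reasoning
    𝟘≢Δ : 𝟘 ≢ Δ
    𝟘≢Δ = Δ≢𝟘 ∘ sym
    below-ε̂ : ∀ j → ε C (punchIn 𝟘 j) s ≤ x
    below-ε̂ j = ε≤ε̂ C s x-is-ε̂ (punchIn 𝟘 j) (punchInᵢ≢i 𝟘 j)
    sums-agree : ∑ℚ (λ j → ε C (punchIn 𝟘 j) s) ≡ ∑ℚ {n} (λ _ → x)
    sums-agree = trans ∑ε-nonzero≡a∸aₛ (trans (sym average) (sym (∑ℚ-const {n} x)))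

mainTheorem15 : (k m : ℕ) (G : FinAbGroup (suc (suc k))) (C : AMDCode G m)
  (s : Fin m) (x : ℚ) → IsEpsHat C s x →
  (x ≡ (+ (a C ∸ aₛ C s)) / suc k →
    ∀ Δ → Δ ≢ FinAbGroup.𝟘 G → ε C Δ s ≡ (+ (a C ∸ aₛ C s)) / suc k)
  × ((∀ Δ → Δ ≢ FinAbGroup.𝟘 G → ε C Δ s ≡ (+ (a C ∸ aₛ C s)) / suc k) →
    x ≡ (+ (a C ∸ aₛ C s)) / suc k)
mainTheorem15 k m G C s x x-is-ε̂ =
    (λ x≡c Δ Δ≢𝟘 → trans (ε≡ε̂-if-ε̂-average C s x-is-ε̂ (average x≡c) Δ Δ≢𝟘) x≡c)
  , ε̂≡-if-ε-const C s x-is-ε̂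
  where
  average : x ≡ (+ (a C ∸ aₛ C s)) / suc k → ι (suc k) * x ≡ ι (a C ∸ aₛ C s)
  average x≡c = trans (cong (ι (suc k) *_) x≡c) (ι*-/-cancel (+ (a C ∸ aₛ C s)) k)
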